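{- Let $n \ge 1$ and $k \ge 0$ be integers and let $p:\mathbf{F}_2^n \to \mathbf{F}_2$ be a polynomial of degree at most $2$. Let $f(x) = (-1)^{p(x)}$. Then \[ \sum_{A \subset [n],\, |A| = k} |\hat f(A)| \le (1+\sqrt{2})^k . \]
   Context: For $f:\mathbf{F}_2^n \to \mathbf{C}$ and $A \subset [n]=\{1,\dots,n\}$, the Fourier coefficient is $\hat f(A) = \frac{1}{2^n}\sum_{x \in \mathbf{F}_2^n} f(x)(-1)^{x_A}$, where $x_A = \sum_{i\in A} x_i$. The quantity $\sum_{|A|=k}|\hat f(A)|$ is called the $k$-th Fourier weight of $f$. -}

module Defs where

open import Data.Bool using (Bool; true; false; _xor_; _∧_)
open import Data.Nat using (ℕ; zero; suc; _≟_)
open import Data.Integer using (ℤ; +_; -[1+_])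
open import Data.Rational using (ℚ; _+_; _*_; 0ℚ; 1ℚ; ∣_∣; _/_)
open import Data.Vec using (Vec; []; _∷_; zipWith; foldr)
open import Data.List using (List; []; _∷_; map; _++_; filter)
open import Data.Fin.Subset using (Subset) renaming (∣_∣ to card)

-- F₂ is modelled by Bool with xor as addition and ∧ as multiplication.
-- A point of F₂ⁿ is a Vec Bool n; a subset A ⊆ [n] is a Subset n (= Vec Bool n).

allVecs : (n : ℕ) → List (Vec Bool n)
allVecs zero = [] ∷ []
allVecs (suc n) = map (false ∷_) (allVecs n) ++ map (true ∷_) (allVecs n)

sumℚ : List ℚ → ℚ
sumℚ [] = 0ℚ
sumℚ (q ∷ qs) = q + sumℚ qs

_^ℚ_ : ℚ → ℕ → ℚ
q ^ℚ zero = 1ℚ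
q ^ℚ suc k = q * (q ^ℚ k)

xorSum : ∀ {n} → Vec Bool n → Bool
xorSum = foldr _ _xor_ false

x[_] : ∀ {n} → Subset n → Vec Bool n → Bool
x[ A ] x = xorSum (zipWith _∧_ A x)

signℚ : Bool → ℚ
signℚ false = 1ℚ
signℚ true  = (-[1+ 0 ]) / 1

half : ℚ
half = (+ 1) / 2

fourier : ∀ {n} → (Vec Bool n → ℚ) → Subset n → ℚ
fourier {n} f A = (half ^ℚ n) * sumℚ (map (λ x → f x * signℚ (x[ A ] x)) (allVecs n))

subsetsOfSize : (n k : ℕ) → List (Subset n)
subsetsOfSize n k = filter (λ A → card A ≟ k) (allVecs n)

fourierWeight : ∀ {n} → (Vec Bool n → ℚ) → ℕ → ℚ
fourierWeight {n} f k = sumℚ (map (λ A → ∣ fourier f A ∣) (subsetsOfSize n k))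

-- polynomial over F₂ of degree ≤ 2:  c + Σ_i a_i x_i + Σ_{i,j} b_{ij} x_i x_j
quadPoly : ∀ {n} → Bool → Vec Bool n → Vec (Vec Bool n) n → Vec Bool n → Bool
quadPoly c a b x = c xor (xorSum (zipWith _∧_ a x)
                     xor xorSum (zipWith (λ bi xi → xi ∧ xorSum (zipWith _∧_ bi x)) b x))

IsDegLe2 : ∀ {n} → (Vec Bool n → Bool) → Set
IsDegLe2 {n} p = Σ Bool λ c → Σ (Vec Bool n) λ a → Σ (Vec (Vec Bool n) n) λ b →
  ∀ x → p x ≡ quadPoly c a b x
  where open import Data.Product using (Σ)
        open import Relation.Binary.PropositionalEquality using (_≡_)

-- Write Φₜ(p) = Σ_A t^|A| |f̂(A)| for f = (-1)^p. The k-th Fourier weight is at most t^-k Φₜ(p), so it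
-- suffices to show Φₜ(p) ≤ 1 for t = 1/(1+q), which satisfies (1+t)² ≤ 2 because q² > 2.
-- "Degree ≤ 2" is taken semantically, as the vanishing of all third derivatives; this class is closed
-- under affine substitutions. Splitting off x₁, write p(x₁,y) = p₀(y) + x₁ g(y) with g affine.
-- If g is constant, the coefficients at (α,A) equal p̂₀(A) for one value of α and vanish for the
-- other, so Φₜ(p) ≤ max(1,t) Φₜ(p₀). Otherwise g flips with some coordinate y_j; summing out x₁
-- restricts to the hyperplane g = α, parametrised by the remaining coordinates, and every coefficient
-- at (α,A) is half a coefficient of a quadratic function of the n − 2 variables other than x₁, y_j.
-- Induction then gives Φₜ(p) ≤ (1+t)(1+t)/2 ≤ 1.

module Submission where

open import Defs
open import Algebra.Bundles using (CommutativeRing)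
open import Data.Bool using (Bool; true; false; _xor_; _∧_)
open import Data.Bool.Properties
  using (xor-∧-commutativeRing; xor-assoc; xor-comm; xor-same; xor-identityˡ; xor-identityʳ;
         ∧-distribˡ-xor; ∧-distribʳ-xor; ∧-zeroʳ; ∧-identityʳ)
open import Data.Fin using (Fin; zero; suc)
open import Data.Fin.Subset using (Subset) renaming (∣_∣ to card)
open import Data.Nat using (ℕ; zero; suc; _≟_; _≤_)
open import Data.Product using (Σ-syntax; _×_; _,_)
open import Data.Sum using (_⊎_; inj₁; inj₂; [_,_]′)
open import Data.Vec using (Vec; []; _∷_; zipWith; replicate; insertAt)
open import Data.Vec.Properties using (zipWith-identityˡ; zipWith-identityʳ)
open import Data.List using (List; []; _∷_; map; _++_; filter)
import Data.List.Properties as List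
open import Data.Rational
  using (ℚ; 0ℚ; 1ℚ; _+_; _*_; -_; 1/_; ∣_∣; _<_; Positive; NonZero; positive; nonNegative)
  renaming (_≤_ to _≤ℚ_)
import Data.Rational.Properties as ℚ
open import Data.Rational.Solver using (module +-*-Solver)
open import Function using (_∘_; const)
open import Relation.Nullary using (yes; no)
open import Relation.Binary.PropositionalEquality
  using (_≡_; _≗_; refl; sym; trans; cong; cong₂; module ≡-Reasoning)

import Algebra.Properties.CommutativeSemigroup as CommutativeSemigroupProperties

open CommutativeRing using (+-commutativeSemigroup; *-commutativeSemigroup)
module Xor = CommutativeSemigroupProperties (+-commutativeSemigroup xor-∧-commutativeRing)
module ℚ+  = CommutativeSemigroupProperties (+-commutativeSemigroup ℚ.+-*-commutativeRing)
module ℚ*  = CommutativeSemigroupProperties (*-commutativeSemigroup ℚ.+-*-commutativeRing)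

private variable
  m n d : ℕ

xor-cancelʳ : ∀ a b → (a xor b) xor b ≡ a
xor-cancelʳ a b = trans (xor-assoc a b b) (trans (cong (a xor_) (xor-same b)) (xor-identityʳ a))

xor-moveʳ : ∀ {a b c} → a xor b ≡ c → a ≡ c xor b
xor-moveʳ {a} {b} eq = trans (sym (xor-cancelʳ a b)) (cong (_xor b) eq)

*-nonNeg : {a b : ℚ} → 0ℚ ≤ℚ a → 0ℚ ≤ℚ b → 0ℚ ≤ℚ a * b
*-nonNeg {a} {b} 0≤a 0≤b =
  ℚ.nonNegative⁻¹ _ {{ℚ.nonNeg*nonNeg⇒nonNeg a {{nonNegative 0≤a}} b {{nonNegative 0≤b}}}}

*-monoˡ-≤ : {a b c : ℚ} → 0ℚ ≤ℚ c → a ≤ℚ b → c * a ≤ℚ c * b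
*-monoˡ-≤ {c = c} 0≤c = ℚ.*-monoˡ-≤-nonNeg c {{nonNegative 0≤c}}

^ℚ-nonNeg : {t : ℚ} → 0ℚ ≤ℚ t → ∀ k → 0ℚ ≤ℚ t ^ℚ k
^ℚ-nonNeg 0≤t zero    = ℚ.nonNegative⁻¹ 1ℚ
^ℚ-nonNeg 0≤t (suc k) = *-nonNeg 0≤t (^ℚ-nonNeg 0≤t k)

^ℚ-distrib-* : ∀ a b k → (a * b) ^ℚ k ≡ a ^ℚ k * b ^ℚ k
^ℚ-distrib-* a b zero    = refl
^ℚ-distrib-* a b (suc k) = trans (cong ((a * b) *_) (^ℚ-distrib-* a b k)) (ℚ*.interchange a b _ _)

1^ℚ : ∀ k → 1ℚ ^ℚ k ≡ 1ℚ
1^ℚ zero    = refl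
1^ℚ (suc k) = trans (ℚ.*-identityˡ _) (1^ℚ k)

reciprocal-^ℚ-bound : ∀ {t r w} k → t * r ≡ 1ℚ → 0ℚ ≤ℚ r → t ^ℚ k * w ≤ℚ 1ℚ → w ≤ℚ r ^ℚ k
reciprocal-^ℚ-bound {t} {r} {w} k tr≡1 0≤r tᵏw≤1 = begin
  w                      ≡⟨ trans (cong (_* w) (1^ℚ k)) (ℚ.*-identityˡ w) ⟨
  1ℚ ^ℚ k * w            ≡⟨ cong (λ x → x ^ℚ k * w) (trans (sym tr≡1) (ℚ.*-comm t r)) ⟩
  (r * t) ^ℚ k * w       ≡⟨ cong (_* w) (^ℚ-distrib-* r t k) ⟩
  (r ^ℚ k * t ^ℚ k) * w  ≡⟨ ℚ.*-assoc (r ^ℚ k) _ w ⟩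
  r ^ℚ k * (t ^ℚ k * w)  ≤⟨ *-monoˡ-≤ (^ℚ-nonNeg 0≤r k) tᵏw≤1 ⟩
  r ^ℚ k * 1ℚ            ≡⟨ ℚ.*-identityʳ _ ⟩
  r ^ℚ k                 ∎
  where open ℚ.≤-Reasoning

+-cancelʳ-≤ : ∀ {a b} c → a + c ≤ℚ b + c → a ≤ℚ b
+-cancelʳ-≤ {a} {b} c a+c≤b+c = begin
  a              ≡⟨ cancel a ⟨
  a + c + - c    ≤⟨ ℚ.+-monoˡ-≤ (- c) a+c≤b+c ⟩
  b + c + - c    ≡⟨ cancel b ⟩
  b              ∎
  where
  open ℚ.≤-Reasoning
  open +-*-Solver
  cancel : ∀ x → x + c + - c ≡ x
  cancel x = solve 2 (λ x c → x :+ c :+ :- c := x) refl x c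

[2+q]²≤2[1+q]² : ∀ q → 1ℚ + 1ℚ < q * q →
                 ((1ℚ + q) + 1ℚ) * ((1ℚ + q) + 1ℚ) ≤ℚ (1ℚ + 1ℚ) * ((1ℚ + q) * (1ℚ + q))
[2+q]²≤2[1+q]² q 2<q² = +-cancelʳ-≤ (1ℚ + 1ℚ) (begin
  ((1ℚ + q) + 1ℚ) * ((1ℚ + q) + 1ℚ) + (1ℚ + 1ℚ)
    ≤⟨ ℚ.+-monoʳ-≤ (((1ℚ + q) + 1ℚ) * ((1ℚ + q) + 1ℚ)) (ℚ.<⇒≤ 2<q²) ⟩
  ((1ℚ + q) + 1ℚ) * ((1ℚ + q) + 1ℚ) + q * q
    ≡⟨ solve 1 (λ q → ((Κ :+ q) :+ Κ) :* ((Κ :+ q) :+ Κ) :+ q :* q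
                      := (Κ :+ Κ) :* ((Κ :+ q) :* (Κ :+ q)) :+ (Κ :+ Κ)) refl q ⟩
  (1ℚ + 1ℚ) * ((1ℚ + q) * (1ℚ + q)) + (1ℚ + 1ℚ) ∎)
  where
  open ℚ.≤-Reasoning
  open +-*-Solver
  Κ = con 1ℚ

reciprocal-admissible : ∀ q → 0ℚ ≤ℚ q → 1ℚ + 1ℚ < q * q →
  Σ[ t ∈ ℚ ] t * (1ℚ + q) ≡ 1ℚ × 0ℚ ≤ℚ t × t ≤ℚ 1ℚ × (1ℚ + t) * (1ℚ + t) ≤ℚ 1ℚ + 1ℚ
reciprocal-admissible q 0≤q 2<q² = t , t*r≡1 , 0≤t , t≤1 , [1+t]²≤2
  where
  open ℚ.≤-Reasoning
  r = 1ℚ + q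
  instance
    r-pos : Positive r
    r-pos = positive (ℚ.+-mono-<-≤ (ℚ.positive⁻¹ 1ℚ) 0≤q)
    r-nonZero : NonZero r
    r-nonZero = ℚ.pos⇒nonZero r
  t = 1/ r
  t*r≡1 : t * r ≡ 1ℚ
  t*r≡1 = ℚ.*-inverseˡ r
  0≤t : 0ℚ ≤ℚ t
  0≤t = ℚ.<⇒≤ (ℚ.positive⁻¹ t {{ℚ.1/pos⇒pos r}})
  t≤1 : t ≤ℚ 1ℚ
  t≤1 = begin
    t       ≡⟨ ℚ.*-identityʳ t ⟨
    t * 1ℚ  ≤⟨ *-monoˡ-≤ 0≤t (ℚ.+-monoʳ-≤ 1ℚ 0≤q) ⟩
    t * r   ≡⟨ t*r≡1 ⟩
    1ℚ      ∎
  [1+t]r≡r+1 : (1ℚ + t) * r ≡ r + 1ℚ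
  [1+t]r≡r+1 = trans (ℚ.*-distribʳ-+ r 1ℚ t) (cong₂ _+_ (ℚ.*-identityˡ r) t*r≡1)
  [1+t]²≤2 : (1ℚ + t) * (1ℚ + t) ≤ℚ 1ℚ + 1ℚ
  [1+t]²≤2 = ℚ.*-cancelʳ-≤-pos (r * r) {{ℚ.pos*pos⇒pos r r}} (begin
    ((1ℚ + t) * (1ℚ + t)) * (r * r)  ≡⟨ ℚ*.interchange (1ℚ + t) (1ℚ + t) r r ⟩
    ((1ℚ + t) * r) * ((1ℚ + t) * r)  ≡⟨ cong (λ x → x * x) [1+t]r≡r+1 ⟩
    (r + 1ℚ) * (r + 1ℚ)              ≤⟨ [2+q]²≤2[1+q]² q 2<q² ⟩
    (1ℚ + 1ℚ) * (r * r)              ∎)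

infixl 6 _⊕_

_⊕_ : Vec Bool n → Vec Bool n → Vec Bool n
_⊕_ = zipWith _xor_

𝟎 : Vec Bool n
𝟎 = replicate _ false

⊕-identityˡ : (x : Vec Bool n) → 𝟎 ⊕ x ≡ x
⊕-identityˡ = zipWith-identityˡ xor-identityˡ

⊕-identityʳ : (x : Vec Bool n) → x ⊕ 𝟎 ≡ x
⊕-identityʳ = zipWith-identityʳ xor-identityʳ

insertAt-⊕ : (u v : Vec Bool n) (j : Fin (suc n)) (a b : Bool) →
             insertAt (u ⊕ v) j (a xor b) ≡ insertAt u j a ⊕ insertAt v j b
insertAt-⊕ u       v       zero    a b = refl
insertAt-⊕ (c ∷ u) (e ∷ v) (suc j) a b = cong ((c xor e) ∷_) (insertAt-⊕ u v j a b)

Linear : (Vec Bool n → Bool) → Set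
Linear l = ∀ u v → l (u ⊕ v) ≡ l u xor l v

x[]-linear : (A : Vec Bool n) → Linear x[ A ]
x[]-linear []      []      []      = refl
x[]-linear (a ∷ A) (u ∷ us) (v ∷ vs) =
  trans (cong₂ _xor_ (∧-distribˡ-xor a u v) (x[]-linear A us vs)) (Xor.interchange (a ∧ u) (a ∧ v) _ _)

x[]-insertAt : (A y : Vec Bool n) (j : Fin (suc n)) (a b : Bool) →
               x[ insertAt A j a ] (insertAt y j b) ≡ x[ A ] y xor (a ∧ b)
x[]-insertAt A       y       zero    a b = xor-comm (a ∧ b) _
x[]-insertAt (c ∷ A) (e ∷ y) (suc j) a b =
  trans (cong ((c ∧ e) xor_) (x[]-insertAt A y j a b)) (sym (xor-assoc (c ∧ e) _ _))

Δ : Vec Bool n → (Vec Bool n → Bool) → Vec Bool n → Bool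
Δ h p x = p (h ⊕ x) xor p x

data DegreeBelow : ℕ → (Vec Bool n → Bool) → Set where
  vanishes : {p : Vec Bool n → Bool} → (∀ x → p x ≡ false) → DegreeBelow zero p
  by-Δ     : {p : Vec Bool n → Bool} → (∀ h → DegreeBelow d (Δ h p)) → DegreeBelow (suc d) p

Quadratic : (Vec Bool n → Bool) → Set
Quadratic = DegreeBelow 3

DegreeBelow-cong : {p q : Vec Bool n → Bool} → p ≗ q → DegreeBelow d p → DegreeBelow d q
DegreeBelow-cong p≗q (vanishes p0) = vanishes (λ x → trans (sym (p≗q x)) (p0 x))
DegreeBelow-cong p≗q (by-Δ dp)     =
  by-Δ λ h → DegreeBelow-cong (λ x → cong₂ _xor_ (p≗q (h ⊕ x)) (p≗q x)) (dp h)

DegreeBelow-suc : {p : Vec Bool n → Bool} → DegreeBelow d p → DegreeBelow (suc d) p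
DegreeBelow-suc (vanishes p0) = by-Δ λ h → vanishes λ x → cong₂ _xor_ (p0 (h ⊕ x)) (p0 x)
DegreeBelow-suc (by-Δ dp)     = by-Δ λ h → DegreeBelow-suc (dp h)

DegreeBelow-false : DegreeBelow {n} d (const false)
DegreeBelow-false {d = zero}  = vanishes λ x → refl
DegreeBelow-false {d = suc _} = by-Δ λ h → DegreeBelow-false

DegreeBelow-const : ∀ b → DegreeBelow {n} 1 (const b)
DegreeBelow-const b = by-Δ λ h → vanishes λ x → xor-same b

DegreeBelow-xor : {p q : Vec Bool n → Bool} → DegreeBelow d p → DegreeBelow d q →
                  DegreeBelow d (λ x → p x xor q x)
DegreeBelow-xor (vanishes p0) (vanishes q0) = vanishes λ x → cong₂ _xor_ (p0 x) (q0 x)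
DegreeBelow-xor {p = p} {q} (by-Δ dp) (by-Δ dq) = by-Δ λ h →
  DegreeBelow-cong (λ x → Xor.interchange (p (h ⊕ x)) (p x) (q (h ⊕ x)) (q x))
                   (DegreeBelow-xor (dp h) (dq h))

DegreeBelow-∧ : ∀ a {p : Vec Bool n → Bool} → DegreeBelow d p → DegreeBelow d (λ x → a ∧ p x)
DegreeBelow-∧ true  dp = dp
DegreeBelow-∧ false dp = DegreeBelow-false

DegreeBelow-∘ : {p : Vec Bool n → Bool} {φ ψ : Vec Bool m → Vec Bool n} →
                (∀ h x → φ (h ⊕ x) ≡ ψ h ⊕ φ x) → DegreeBelow d p → DegreeBelow d (p ∘ φ)
DegreeBelow-∘ φ-affine (vanishes p0) = vanishes λ x → p0 _
DegreeBelow-∘ {p = p} {φ} φ-affine (by-Δ dp) = by-Δ λ h →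
  DegreeBelow-cong (λ x → cong (λ y → p y xor p (φ x)) (sym (φ-affine h x)))
                   (DegreeBelow-∘ φ-affine (dp _))

DegreeBelow1⇒const : {f : Vec Bool n → Bool} → DegreeBelow 1 f → ∀ x → f x ≡ f 𝟎
DegreeBelow1⇒const {f = f} (by-Δ f1) x with f1 x
... | vanishes Δf = trans (cong f (sym (⊕-identityʳ x))) (xor-moveʳ (Δf 𝟎))

DegreeBelow2⇒affine : {g : Vec Bool n → Bool} → DegreeBelow 2 g →
                      ∀ h x → g (h ⊕ x) ≡ (g h xor g 𝟎) xor g x
DegreeBelow2⇒affine {g = g} (by-Δ g2) h x =
  trans (xor-moveʳ (DegreeBelow1⇒const (g2 h) x))
        (cong (λ y → (g y xor g 𝟎) xor g x) (⊕-identityʳ h))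

Linear⇒DegreeBelow2 : {l : Vec Bool n → Bool} → Linear l → DegreeBelow 2 l
Linear⇒DegreeBelow2 {l = l} lin = by-Δ λ h →
  DegreeBelow-cong (λ x → sym (trans (cong (_xor l x) (lin h x)) (xor-cancelʳ (l h) (l x))))
                   (DegreeBelow-const (l h))

Bilinear : (Vec Bool n → Vec Bool n → Bool) → Set
Bilinear b = (∀ v → Linear (λ u → b u v)) × (∀ u → Linear (b u))

diagonal-quadratic : {b : Vec Bool n → Vec Bool n → Bool} → Bilinear b → Quadratic (λ x → b x x)
diagonal-quadratic {b = b} (linˡ , linʳ) = by-Δ λ h →
  DegreeBelow-cong (expand h)
    (DegreeBelow-xor (DegreeBelow-xor (DegreeBelow-suc (DegreeBelow-const (b h h)))
                                      (Linear⇒DegreeBelow2 (linʳ h)))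
                     (Linear⇒DegreeBelow2 (linˡ h)))
  where
  open ≡-Reasoning
  expand : ∀ h x → (b h h xor b h x) xor b x h ≡ Δ h (λ x → b x x) x
  expand h x = sym (begin
    b (h ⊕ x) (h ⊕ x) xor b x x
      ≡⟨ cong (_xor b x x) (trans (linˡ (h ⊕ x) h x) (cong₂ _xor_ (linʳ h h x) (linʳ x h x))) ⟩
    ((b h h xor b h x) xor (b x h xor b x x)) xor b x x
      ≡⟨ xor-assoc (b h h xor b h x) (b x h xor b x x) (b x x) ⟩
    (b h h xor b h x) xor ((b x h xor b x x) xor b x x)
      ≡⟨ cong ((b h h xor b h x) xor_) (xor-cancelʳ _ _) ⟩
    (b h h xor b h x) xor b x h ∎)

-- With this definition quadPoly c a B x is definitionally c xor (x[ a ] x xor bilinear B x x).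
bilinear : Vec (Vec Bool n) m → Vec Bool m → Vec Bool n → Bool
bilinear B u v = xorSum (zipWith (λ bᵢ uᵢ → uᵢ ∧ x[ bᵢ ] v) B u)

bilinear-Bilinear : (B : Vec (Vec Bool n) n) → Bilinear (bilinear B)
bilinear-Bilinear B = linearˡ B , linearʳ B
  where
  linearˡ : (B : Vec (Vec Bool n) m) → ∀ v → Linear (λ u → bilinear B u v)
  linearˡ []      v []       []       = refl
  linearˡ (b ∷ B) v (u ∷ us) (u' ∷ us') =
    trans (cong₂ _xor_ (∧-distribʳ-xor (x[ b ] v) u u') (linearˡ B v us us'))
          (Xor.interchange (u ∧ x[ b ] v) (u' ∧ x[ b ] v) _ _)
  linearʳ : (B : Vec (Vec Bool n) m) → ∀ u → Linear (bilinear B u)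
  linearʳ []      []       v v' = refl
  linearʳ (b ∷ B) (u ∷ us) v v' =
    trans (cong₂ _xor_ (trans (cong (u ∧_) (x[]-linear b v v')) (∧-distribˡ-xor u _ _))
                       (linearʳ B us v v'))
          (Xor.interchange (u ∧ x[ b ] v) (u ∧ x[ b ] v') _ _)

quadPoly-quadratic : ∀ c a (B : Vec (Vec Bool n) n) → Quadratic (quadPoly c a B)
quadPoly-quadratic c a B =
  DegreeBelow-xor (DegreeBelow-suc (DegreeBelow-suc (DegreeBelow-const c)))
    (DegreeBelow-xor {p = x[ a ]} (DegreeBelow-suc (Linear⇒DegreeBelow2 (x[]-linear a)))
                     (diagonal-quadratic {b = bilinear B} (bilinear-Bilinear B)))

DegreeBelow-insertAt : (j : Fin (suc n)) {p : Vec Bool (suc n) → Bool} {c : Vec Bool n → Bool} →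
                       DegreeBelow 2 c → DegreeBelow d p → DegreeBelow d (λ y → p (insertAt y j (c y)))
DegreeBelow-insertAt j {c = c} c2 =
  DegreeBelow-∘ {ψ = λ h → insertAt h j (c h xor c 𝟎)}
    (λ h x → trans (cong (insertAt (h ⊕ x) j) (DegreeBelow2⇒affine c2 h x)) (insertAt-⊕ h x j _ _))

DegreeBelow-false∷ : {p : Vec Bool (suc n) → Bool} → DegreeBelow d p → DegreeBelow d (p ∘ (false ∷_))
DegreeBelow-false∷ = DegreeBelow-∘ {φ = false ∷_} {ψ = false ∷_} λ h x → refl

∂₁ : (Vec Bool (suc n) → Bool) → Vec Bool n → Bool
∂₁ p y = p (true ∷ y) xor p (false ∷ y)

∂₁-degree : {p : Vec Bool (suc n) → Bool} → DegreeBelow (suc d) p → DegreeBelow d (∂₁ p)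
∂₁-degree {p = p} (by-Δ dp) =
  DegreeBelow-cong (λ y → cong (λ z → p (true ∷ z) xor p (false ∷ y)) (⊕-identityˡ y))
                   (DegreeBelow-false∷ (dp (true ∷ 𝟎)))

record Pivot (g : Vec Bool (suc n) → Bool) : Set where
  constructor pivot
  field
    index : Fin (suc n)
    flips : ∀ y b → g (insertAt y index b) ≡ g (insertAt y index false) xor b

affine-true∷ : {g : Vec Bool (suc n) → Bool} → DegreeBelow 2 g →
               ∀ y → g (true ∷ y) ≡ ∂₁ g 𝟎 xor g (false ∷ y)
affine-true∷ g2 y = xor-moveʳ (DegreeBelow1⇒const (∂₁-degree g2) y)

constant-or-pivot : {g : Vec Bool (suc n) → Bool} → DegreeBelow 2 g → (∀ y → g y ≡ g 𝟎) ⊎ Pivot g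
constant-or-pivot {g = g} g2 with ∂₁ g 𝟎 | affine-true∷ g2
constant-or-pivot g2 | true | g-true =
  inj₂ (pivot zero λ { y false → sym (xor-identityʳ _) ; y true → trans (g-true y) (xor-comm true _) })
constant-or-pivot {zero} g2 | false | g-true =
  inj₁ λ { (false ∷ []) → refl ; (true ∷ []) → g-true [] }
constant-or-pivot {suc n} g2 | false | g-true
  with constant-or-pivot (DegreeBelow-false∷ g2)
... | inj₁ g₀-const = inj₁ λ { (false ∷ y) → g₀-const y ; (true ∷ y) → trans (g-true y) (g₀-const y) }
... | inj₂ (pivot j piv) = inj₂ (pivot (suc j) λ
  { (false ∷ y) b → piv y b
  ; (true ∷ y) b → trans (g-true (insertAt y j b))
                         (trans (piv y b) (cong (_xor b) (sym (g-true (insertAt y j false))))) })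

∑ : ∀ n → (Vec Bool n → ℚ) → ℚ
∑ zero    F = F []
∑ (suc n) F = ∑ n (F ∘ (false ∷_)) + ∑ n (F ∘ (true ∷_))

∑-cong : {F G : Vec Bool n → ℚ} → F ≗ G → ∑ n F ≡ ∑ n G
∑-cong {zero}  F≗G = F≗G []
∑-cong {suc n} F≗G = cong₂ _+_ (∑-cong (F≗G ∘ (false ∷_))) (∑-cong (F≗G ∘ (true ∷_)))

∑-+ : (F G : Vec Bool n → ℚ) → ∑ n (λ x → F x + G x) ≡ ∑ n F + ∑ n G
∑-+ {zero}  F G = refl
∑-+ {suc n} F G =
  trans (cong₂ _+_ (∑-+ (F ∘ (false ∷_)) (G ∘ (false ∷_))) (∑-+ (F ∘ (true ∷_)) (G ∘ (true ∷_))))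
        (ℚ+.interchange (∑ n (F ∘ (false ∷_))) _ (∑ n (F ∘ (true ∷_))) (∑ n (G ∘ (true ∷_))))

∑-*ˡ : ∀ c (F : Vec Bool n → ℚ) → ∑ n (λ x → c * F x) ≡ c * ∑ n F
∑-*ˡ {zero}  c F = refl
∑-*ˡ {suc n} c F =
  trans (cong₂ _+_ (∑-*ˡ c (F ∘ (false ∷_))) (∑-*ˡ c (F ∘ (true ∷_)))) (sym (ℚ.*-distribˡ-+ c _ _))

∑-insertAt : (j : Fin (suc n)) (F : Vec Bool (suc n) → ℚ) →
             ∑ (suc n) F ≡ ∑ n (λ y → F (insertAt y j false)) + ∑ n (λ y → F (insertAt y j true))
∑-insertAt             zero    F = refl
∑-insertAt {n = suc n} (suc j) F =
  trans (cong₂ _+_ (∑-insertAt j (F ∘ (false ∷_))) (∑-insertAt j (F ∘ (true ∷_))))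
        (ℚ+.interchange (S false false) (S false true) (S true false) (S true true))
  where
  S : Bool → Bool → ℚ
  S b c = ∑ n (λ y → F (b ∷ insertAt y j c))

sumℚ-++ : (xs ys : List ℚ) → sumℚ (xs ++ ys) ≡ sumℚ xs + sumℚ ys
sumℚ-++ []       ys = sym (ℚ.+-identityˡ _)
sumℚ-++ (x ∷ xs) ys = trans (cong (x +_) (sumℚ-++ xs ys)) (sym (ℚ.+-assoc x _ _))

sumℚ-allVecs : (F : Vec Bool n → ℚ) → sumℚ (map F (allVecs n)) ≡ ∑ n F
sumℚ-allVecs {zero}  F = ℚ.+-identityʳ (F [])
sumℚ-allVecs {suc n} F = begin
  sumℚ (map F (map (false ∷_) (allVecs n) ++ map (true ∷_) (allVecs n)))
    ≡⟨ cong sumℚ (List.map-++ F (map (false ∷_) (allVecs n)) _) ⟩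
  sumℚ (map F (map (false ∷_) (allVecs n)) ++ map F (map (true ∷_) (allVecs n)))
    ≡⟨ sumℚ-++ (map F (map (false ∷_) (allVecs n))) _ ⟩
  sumℚ (map F (map (false ∷_) (allVecs n))) + sumℚ (map F (map (true ∷_) (allVecs n)))
    ≡⟨ cong₂ _+_ (trans (cong sumℚ (sym (List.map-∘ (allVecs n)))) (sumℚ-allVecs (F ∘ (false ∷_))))
                 (trans (cong sumℚ (sym (List.map-∘ (allVecs n)))) (sumℚ-allVecs (F ∘ (true ∷_)))) ⟩
  ∑ (suc n) F ∎
  where open ≡-Reasoning

signℚ-xor : ∀ a b → signℚ (a xor b) ≡ signℚ a * signℚ b
signℚ-xor false false = refl
signℚ-xor false true  = refl
signℚ-xor true  false = refl
signℚ-xor true  true  = refl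

bias : (Vec Bool n → Bool) → ℚ
bias {n} p = half ^ℚ n * ∑ n (signℚ ∘ p)

bias-cong : {p q : Vec Bool n → Bool} → p ≗ q → bias p ≡ bias q
bias-cong {n} p≗q = cong (half ^ℚ n *_) (∑-cong (cong signℚ ∘ p≗q))

bias-∷ : (p : Vec Bool (suc n) → Bool) → bias p ≡ half * (bias (p ∘ (false ∷_)) + bias (p ∘ (true ∷_)))
bias-∷ {n} p = trans (ℚ.*-assoc half (half ^ℚ n) _) (cong (half *_) (ℚ.*-distribˡ-+ (half ^ℚ n) _ _))

bias-xor-const : (p : Vec Bool n → Bool) (e : Bool) → bias (λ x → p x xor e) ≡ signℚ e * bias p
bias-xor-const {n} p e = begin
  half ^ℚ n * ∑ n (λ x → signℚ (p x xor e))
    ≡⟨ cong (half ^ℚ n *_) (∑-cong λ x → trans (signℚ-xor (p x) e) (ℚ.*-comm (signℚ (p x)) (signℚ e))) ⟩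
  half ^ℚ n * ∑ n (λ x → signℚ e * signℚ (p x))
    ≡⟨ cong (half ^ℚ n *_) (∑-*ˡ (signℚ e) (signℚ ∘ p)) ⟩
  half ^ℚ n * (signℚ e * ∑ n (signℚ ∘ p))
    ≡⟨ ℚ*.x∙yz≈y∙xz (half ^ℚ n) (signℚ e) _ ⟩
  signℚ e * bias p ∎
  where open ≡-Reasoning

-- Since g flips with the pivot coordinate, this choice of that coordinate makes g vanish.
kernelPoint : {g : Vec Bool (suc n) → Bool} → Pivot g → Vec Bool n → Vec Bool (suc n)
kernelPoint {g = g} (pivot j _) y = insertAt y j (g (insertAt y j false))

signℚ-fibre : (R : Bool → Bool) (c : Bool) →
  (signℚ (R false) + signℚ (R false xor c)) + (signℚ (R true) + signℚ (R true xor (c xor true)))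
    ≡ (1ℚ + 1ℚ) * signℚ (R c)
signℚ-fibre R false with R false | R true
... | false | false = refl
... | false | true  = refl
... | true  | false = refl
... | true  | true  = refl
signℚ-fibre R true with R false | R true
... | false | false = refl
... | false | true  = refl
... | true  | false = refl
... | true  | true  = refl

bias-pivot : (r : Vec Bool (suc n) → Bool) {g : Vec Bool (suc n) → Bool} (piv : Pivot g) →
             bias r + bias (λ x → r x xor g x) ≡ bias (r ∘ kernelPoint piv)
bias-pivot {n} r {g} piv@(pivot j g-pivot) = begin
  H′ * ∑ (suc n) (signℚ ∘ r) + H′ * ∑ (suc n) (λ x → signℚ (r x xor g x))
    ≡⟨ sym (ℚ.*-distribˡ-+ H′ _ _) ⟩
  H′ * (∑ (suc n) (signℚ ∘ r) + ∑ (suc n) (λ x → signℚ (r x xor g x)))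
    ≡⟨ cong (H′ *_) (sym (∑-+ (signℚ ∘ r) (λ x → signℚ (r x xor g x)))) ⟩
  H′ * ∑ (suc n) F
    ≡⟨ cong (H′ *_) (trans (∑-insertAt j F) (sym (∑-+ (λ y → F (insertAt y j false)) _))) ⟩
  H′ * ∑ n (λ y → F (insertAt y j false) + F (insertAt y j true))
    ≡⟨ cong (H′ *_) (∑-cong fibre) ⟩
  H′ * ∑ n (λ y → (1ℚ + 1ℚ) * signℚ (r (kernelPoint piv y)))
    ≡⟨ cong (H′ *_) (∑-*ˡ (1ℚ + 1ℚ) (signℚ ∘ r ∘ kernelPoint piv)) ⟩
  (half * half ^ℚ n) * ((1ℚ + 1ℚ) * ∑ n (signℚ ∘ r ∘ kernelPoint piv))
    ≡⟨ ℚ*.interchange half (half ^ℚ n) (1ℚ + 1ℚ) _ ⟩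
  1ℚ * bias (r ∘ kernelPoint piv)
    ≡⟨ ℚ.*-identityˡ _ ⟩
  bias (r ∘ kernelPoint piv) ∎
  where
  open ≡-Reasoning
  H′ = half ^ℚ suc n
  F : Vec Bool (suc n) → ℚ
  F x = signℚ (r x) + signℚ (r x xor g x)
  fibre : ∀ y → F (insertAt y j false) + F (insertAt y j true)
                ≡ (1ℚ + 1ℚ) * signℚ (r (kernelPoint piv y))
  fibre y = trans (cong (λ b → F (insertAt y j false) + (signℚ (r₁ y) + signℚ (r₁ y xor b)))
                        (g-pivot y true))
                  (signℚ-fibre (λ b → r (insertAt y j b)) (g (insertAt y j false)))
    where r₁ = λ y → r (insertAt y j true)

walsh : (Vec Bool n → Bool) → Subset n → ℚ
walsh p A = bias (λ x → p x xor x[ A ] x)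

fourier≡walsh : (p : Vec Bool n → Bool) (A : Subset n) → fourier (λ x → signℚ (p x)) A ≡ walsh p A
fourier≡walsh {n} p A =
  cong (half ^ℚ n *_) (trans (sumℚ-allVecs (λ x → signℚ (p x) * signℚ (x[ A ] x)))
                             (∑-cong λ x → sym (signℚ-xor (p x) (x[ A ] x))))

walsh-∷ : (p : Vec Bool (suc n) → Bool) (α : Bool) (A : Subset n) →
          walsh p (α ∷ A) ≡ half * (walsh (p ∘ (false ∷_)) A
                                    + bias (λ y → (p (false ∷ y) xor x[ A ] y) xor (∂₁ p y xor α)))
walsh-∷ p α A = trans (bias-∷ (λ x → p x xor x[ α ∷ A ] x)) (cong (half *_) (cong₂ _+_
  (bias-cong λ y → cong (λ b → p (false ∷ y) xor (b xor x[ A ] y)) (∧-zeroʳ α))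
  (bias-cong λ y → trans (cong (λ b → p (true ∷ y) xor (b xor x[ A ] y)) (∧-identityʳ α))
                         (x₁-true y))))
  where
  x₁-true : ∀ y → p (true ∷ y) xor (α xor x[ A ] y) ≡ (p (false ∷ y) xor x[ A ] y) xor (∂₁ p y xor α)
  x₁-true y = trans (cong (_xor (α xor x[ A ] y)) (xor-moveʳ {a = p (true ∷ y)} refl))
                      (trans (Xor.interchange (∂₁ p y) (p (false ∷ y)) α (x[ A ] y))
                             (xor-comm (∂₁ p y xor α) _))

walsh-∷-const : (p : Vec Bool (suc n) → Bool) {e : Bool} → (∀ y → ∂₁ p y ≡ e) → ∀ α A →
                walsh p (α ∷ A) ≡ (half * (1ℚ + signℚ (e xor α))) * walsh (p ∘ (false ∷_)) A
walsh-∷-const p {e} ∂₁p≡e α A = begin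
  walsh p (α ∷ A)
    ≡⟨ walsh-∷ p α A ⟩
  half * (W + bias (λ y → r y xor (∂₁ p y xor α)))
    ≡⟨ cong (λ b → half * (W + b)) (bias-cong λ y → cong (λ b → r y xor (b xor α)) (∂₁p≡e y)) ⟩
  half * (W + bias (λ y → r y xor (e xor α)))
    ≡⟨ cong (λ b → half * (W + b)) (bias-xor-const r (e xor α)) ⟩
  half * (W + signℚ (e xor α) * W)
    ≡⟨ solve 3 (λ h s w → h :* (w :+ s :* w) := (h :* (con 1ℚ :+ s)) :* w) refl half s W ⟩
  (half * (1ℚ + signℚ (e xor α))) * W ∎
  where
  open ≡-Reasoning
  open +-*-Solver
  r : Vec Bool _ → Bool
  r y = p (false ∷ y) xor x[ A ] y
  W = walsh (p ∘ (false ∷_)) A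
  s = signℚ (e xor α)

Pivot-xor : {g : Vec Bool (suc n) → Bool} → Pivot g → ∀ α → Pivot (λ y → g y xor α)
Pivot-xor {g = g} (pivot j flips) α =
  pivot j λ y b → trans (cong (_xor α) (flips y b)) (Xor.xy∙z≈xz∙y (g (insertAt y j false)) b α)

pivotRestriction : (p : Vec Bool (suc (suc n)) → Bool) → Pivot (∂₁ p) → Bool → Bool → Vec Bool n → Bool
pivotRestriction p (pivot j _) α a y = p (false ∷ insertAt y j c) xor (a ∧ c)
  where c = ∂₁ p (insertAt y j false) xor α

walsh-∷-pivot : (p : Vec Bool (suc (suc n)) → Bool) (piv : Pivot (∂₁ p)) → ∀ α a β →
                walsh p (α ∷ insertAt β (Pivot.index piv) a)
                ≡ half * walsh (pivotRestriction p piv α a) β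
walsh-∷-pivot p piv@(pivot j _) α a β =
  trans (walsh-∷ p α A)
        (cong (half *_) (trans (bias-pivot r (Pivot-xor piv α)) (bias-cong restrict)))
  where
  A = insertAt β j a
  r : Vec Bool _ → Bool
  r y = p (false ∷ y) xor x[ A ] y
  restrict : ∀ y → r (kernelPoint (Pivot-xor piv α) y) ≡ pivotRestriction p piv α a y xor x[ β ] y
  restrict y = trans (cong (p (false ∷ insertAt y j c) xor_) (x[]-insertAt β y j a c))
                     (Xor.x∙yz≈xz∙y (p (false ∷ insertAt y j c)) (x[ β ] y) (a ∧ c))
    where c = ∂₁ p (insertAt y j false) xor α

pivotRestriction-quadratic : {p : Vec Bool (suc (suc n)) → Bool} → Quadratic p →
                             (piv : Pivot (∂₁ p)) → ∀ α a → Quadratic (pivotRestriction p piv α a)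
pivotRestriction-quadratic {p = p} p₃ (pivot j _) α a =
  DegreeBelow-xor (DegreeBelow-insertAt j c₂ (DegreeBelow-false∷ p₃))
                  (DegreeBelow-suc (DegreeBelow-∧ a c₂))
  where
  c₂ : DegreeBelow 2 (λ y → ∂₁ p (insertAt y j false) xor α)
  c₂ = DegreeBelow-xor (DegreeBelow-insertAt j DegreeBelow-false (∂₁-degree p₃))
                       (DegreeBelow-suc (DegreeBelow-const α))

weightedSum : ℚ → (Subset n → ℚ) → ℚ
weightedSum {n} t F = ∑ n (λ A → t ^ℚ card A * F A)

card-insertAt-false : (β : Subset n) (j : Fin (suc n)) → card (insertAt β j false) ≡ card β
card-insertAt-false β           zero    = refl
card-insertAt-false (false ∷ β) (suc j) = card-insertAt-false β j
card-insertAt-false (true ∷ β)  (suc j) = cong suc (card-insertAt-false β j)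

card-insertAt-true : (β : Subset n) (j : Fin (suc n)) → card (insertAt β j true) ≡ suc (card β)
card-insertAt-true β           zero    = refl
card-insertAt-true (false ∷ β) (suc j) = card-insertAt-true β j
card-insertAt-true (true ∷ β)  (suc j) = cong suc (card-insertAt-true β j)

weightedSum-insertAt : ∀ t (j : Fin (suc n)) (F : Subset (suc n) → ℚ) →
  weightedSum t F ≡ weightedSum t (λ β → F (insertAt β j false))
                    + t * weightedSum t (λ β → F (insertAt β j true))
weightedSum-insertAt t j F = trans (∑-insertAt j (λ A → t ^ℚ card A * F A)) (cong₂ _+_
  (∑-cong λ β → cong (λ k → t ^ℚ k * F (insertAt β j false)) (card-insertAt-false β j))
  (trans (∑-cong λ β → trans (cong (λ k → t ^ℚ k * F (insertAt β j true)) (card-insertAt-true β j))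
                             (ℚ.*-assoc t (t ^ℚ card β) _))
         (∑-*ˡ t (λ β → t ^ℚ card β * F (insertAt β j true)))))

weightedSum-abs-scale : ∀ t c {F G : Subset n → ℚ} → (∀ A → F A ≡ c * G A) →
                        weightedSum t (λ A → ∣ F A ∣) ≡ ∣ c ∣ * weightedSum t (λ A → ∣ G A ∣)
weightedSum-abs-scale t c {F} {G} F≡cG =
  trans (∑-cong λ A → trans (cong (λ x → t ^ℚ card A * ∣ x ∣) (F≡cG A))
                      (trans (cong (t ^ℚ card A *_) (ℚ.∣p*q∣≡∣p∣*∣q∣ c (G A)))
                             (ℚ*.x∙yz≈y∙xz (t ^ℚ card A) ∣ c ∣ ∣ G A ∣)))
        (∑-*ˡ ∣ c ∣ (λ A → t ^ℚ card A * ∣ G A ∣))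

sliceSum≤weightedSum : ∀ {t} k {F : Subset n → ℚ} → 0ℚ ≤ℚ t → (∀ A → 0ℚ ≤ℚ F A) →
  (L : List (Subset n)) →
  t ^ℚ k * sumℚ (map F (filter (λ A → card A ≟ k) L)) ≤ℚ sumℚ (map (λ A → t ^ℚ card A * F A) L)
sliceSum≤weightedSum {t = t} k 0≤t 0≤F [] = ℚ.≤-reflexive (ℚ.*-zeroʳ (t ^ℚ k))
sliceSum≤weightedSum {t = t} k {F} 0≤t 0≤F (A ∷ L) with card A ≟ k
... | yes |A|≡k = begin
  t ^ℚ k * sumℚ (map F (filter (λ A → card A ≟ k) (A ∷ L)))
    ≡⟨ cong (λ xs → t ^ℚ k * sumℚ (map F xs)) (List.filter-accept (λ A → card A ≟ k) {A} {L} |A|≡k) ⟩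
  t ^ℚ k * (F A + sumℚ (map F (filter (λ A → card A ≟ k) L)))
    ≡⟨ ℚ.*-distribˡ-+ (t ^ℚ k) (F A) _ ⟩
  t ^ℚ k * F A + t ^ℚ k * sumℚ (map F (filter (λ A → card A ≟ k) L))
    ≤⟨ ℚ.+-monoʳ-≤ (t ^ℚ k * F A) (sliceSum≤weightedSum k 0≤t 0≤F L) ⟩
  t ^ℚ k * F A + sumℚ (map (λ A → t ^ℚ card A * F A) L)
    ≡⟨ cong (λ i → t ^ℚ i * F A + _) (sym |A|≡k) ⟩
  sumℚ (map (λ A → t ^ℚ card A * F A) (A ∷ L)) ∎
  where open ℚ.≤-Reasoning
... | no |A|≢k = begin
  t ^ℚ k * sumℚ (map F (filter (λ A → card A ≟ k) (A ∷ L)))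
    ≡⟨ cong (λ xs → t ^ℚ k * sumℚ (map F xs)) (List.filter-reject (λ A → card A ≟ k) {A} {L} |A|≢k) ⟩
  t ^ℚ k * sumℚ (map F (filter (λ A → card A ≟ k) L))
    ≡⟨ ℚ.+-identityˡ _ ⟨
  0ℚ + t ^ℚ k * sumℚ (map F (filter (λ A → card A ≟ k) L))
    ≤⟨ ℚ.+-mono-≤ (*-nonNeg (^ℚ-nonNeg 0≤t (card A)) (0≤F A)) (sliceSum≤weightedSum k 0≤t 0≤F L) ⟩
  sumℚ (map (λ A → t ^ℚ card A * F A) (A ∷ L)) ∎
  where open ℚ.≤-Reasoning

fourierMass : ℚ → (Vec Bool n → Bool) → ℚ
fourierMass t p = weightedSum t (λ A → ∣ walsh p A ∣)

module _ {t : ℚ} (0≤t : 0ℚ ≤ℚ t) (t≤1 : t ≤ℚ 1ℚ) ([1+t]²≤2 : (1ℚ + t) * (1ℚ + t) ≤ℚ 1ℚ + 1ℚ) where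

  open ℚ.≤-Reasoning

  +-*-mono-≤ : {x x′ y y′ : ℚ} → x ≤ℚ x′ → y ≤ℚ y′ → x + t * y ≤ℚ x′ + t * y′
  +-*-mono-≤ x≤x′ y≤y′ = ℚ.+-mono-≤ x≤x′ (*-monoˡ-≤ 0≤t y≤y′)

  fourierMass≤1-constant : (p : Vec Bool (suc n) → Bool) → (∀ y → ∂₁ p y ≡ ∂₁ p 𝟎) →
                           fourierMass t (p ∘ (false ∷_)) ≤ℚ 1ℚ → fourierMass t p ≤ℚ 1ℚ
  fourierMass≤1-constant p ∂₁p-const M≤1 = begin
    fourierMass t p
      ≡⟨ weightedSum-insertAt t zero (λ A → ∣ walsh p A ∣) ⟩
    weightedSum t (λ A → ∣ walsh p (false ∷ A) ∣) + t * weightedSum t (λ A → ∣ walsh p (true ∷ A) ∣)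
      ≡⟨ cong₂ (λ a b → a + t * b)
               (weightedSum-abs-scale t (c e false) (walsh-∷-const p ∂₁p-const false))
               (weightedSum-abs-scale t (c e true) (walsh-∷-const p ∂₁p-const true)) ⟩
    ∣ c e false ∣ * M + t * (∣ c e true ∣ * M)
      ≤⟨ bound e ⟩
    1ℚ ∎
    where
    e = ∂₁ p 𝟎
    M = fourierMass t (p ∘ (false ∷_))
    c : Bool → Bool → ℚ
    c e α = half * (1ℚ + signℚ (e xor α))
    bound : ∀ e′ → ∣ c e′ false ∣ * M + t * (∣ c e′ true ∣ * M) ≤ℚ 1ℚ
    bound false = begin
      1ℚ * M + t * (0ℚ * M) ≡⟨ solve 2 (λ t M → con 1ℚ :* M :+ t :* (con 0ℚ :* M) := M) refl t M ⟩
      M                     ≤⟨ M≤1 ⟩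
      1ℚ                    ∎
      where open +-*-Solver
    bound true = begin
      0ℚ * M + t * (1ℚ * M) ≡⟨ solve 2 (λ t M → con 0ℚ :* M :+ t :* (con 1ℚ :* M) := t :* M) refl t M ⟩
      t * M                 ≤⟨ *-monoˡ-≤ 0≤t M≤1 ⟩
      t * 1ℚ                ≡⟨ ℚ.*-identityʳ t ⟩
      t                     ≤⟨ t≤1 ⟩
      1ℚ                    ∎
      where open +-*-Solver

  fourierMass≤1-pivot : (p : Vec Bool (suc (suc n)) → Bool) → Quadratic p → Pivot (∂₁ p) →
                        (∀ q → Quadratic q → fourierMass t q ≤ℚ 1ℚ) → fourierMass t p ≤ℚ 1ℚ
  fourierMass≤1-pivot p p₃ piv@(pivot j _) fourierMass≤1 = begin
    fourierMass t p
      ≡⟨ weightedSum-insertAt t zero (λ A → ∣ walsh p A ∣) ⟩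
    M false + t * M true
      ≤⟨ +-*-mono-≤ (M≤ false) (M≤ true) ⟩
    (half + t * half) + t * (half + t * half)
      ≡⟨ solve 2 (λ h t → (h :+ t :* h) :+ t :* (h :+ t :* h) := h :* ((Κ :+ t) :* (Κ :+ t)))
                 refl half t ⟩
    half * ((1ℚ + t) * (1ℚ + t))
      ≤⟨ *-monoˡ-≤ (ℚ.nonNegative⁻¹ half) [1+t]²≤2 ⟩
    half * (1ℚ + 1ℚ)
      ≡⟨⟩
    1ℚ ∎
    where
    open +-*-Solver
    Κ = con 1ℚ
    M : Bool → ℚ
    M α = weightedSum t (λ A → ∣ walsh p (α ∷ A) ∣)
    half-mass≤half : ∀ α a → ∣ half ∣ * fourierMass t (pivotRestriction p piv α a) ≤ℚ half
    half-mass≤half α a = begin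
      half * fourierMass t (pivotRestriction p piv α a)
        ≤⟨ *-monoˡ-≤ (ℚ.nonNegative⁻¹ half) (fourierMass≤1 _ (pivotRestriction-quadratic p₃ piv α a)) ⟩
      half * 1ℚ
        ≡⟨⟩
      half ∎
    M≤ : ∀ α → M α ≤ℚ half + t * half
    M≤ α = begin
      M α
        ≡⟨ weightedSum-insertAt t j (λ A → ∣ walsh p (α ∷ A) ∣) ⟩
      weightedSum t (λ β → ∣ walsh p (α ∷ insertAt β j false) ∣)
        + t * weightedSum t (λ β → ∣ walsh p (α ∷ insertAt β j true) ∣)
        ≡⟨ cong₂ (λ a b → a + t * b) (weightedSum-abs-scale t half (walsh-∷-pivot p piv α false))
                                     (weightedSum-abs-scale t half (walsh-∷-pivot p piv α true)) ⟩
      ∣ half ∣ * fourierMass t (pivotRestriction p piv α false)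
        + t * (∣ half ∣ * fourierMass t (pivotRestriction p piv α true))
        ≤⟨ +-*-mono-≤ (half-mass≤half α false) (half-mass≤half α true) ⟩
      half + t * half ∎

  fourierMass≤1 : ∀ n (p : Vec Bool n → Bool) → Quadratic p → fourierMass t p ≤ℚ 1ℚ
  fourierMass≤1 zero p _ with p []
  ... | false = ℚ.≤-refl
  ... | true  = ℚ.≤-refl
  fourierMass≤1 (suc zero) p p₃ =
    fourierMass≤1-constant p (λ { [] → refl }) (fourierMass≤1 zero _ (DegreeBelow-false∷ p₃))
  fourierMass≤1 (suc (suc n)) p p₃ =
    [ (λ ∂₁p-const → fourierMass≤1-constant p ∂₁p-const (fourierMass≤1 (suc n) _ p₀₃))
    , (λ piv → fourierMass≤1-pivot p p₃ piv (fourierMass≤1 n))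
    ]′ (constant-or-pivot (∂₁-degree p₃))
    where p₀₃ = DegreeBelow-false∷ p₃

  fourierWeight-bound : (p : Vec Bool n → Bool) → Quadratic p →
                        ∀ k → t ^ℚ k * fourierWeight (λ x → signℚ (p x)) k ≤ℚ 1ℚ
  fourierWeight-bound {n} p p₃ k = begin
    t ^ℚ k * fourierWeight f k
      ≤⟨ sliceSum≤weightedSum k 0≤t (λ A → ℚ.0≤∣p∣ (fourier f A)) (allVecs n) ⟩
    sumℚ (map (λ A → t ^ℚ card A * ∣ fourier f A ∣) (allVecs n))
      ≡⟨ sumℚ-allVecs (λ A → t ^ℚ card A * ∣ fourier f A ∣) ⟩
    weightedSum t (λ A → ∣ fourier f A ∣)
      ≡⟨ ∑-cong (λ A → cong (λ w → t ^ℚ card A * ∣ w ∣) (fourier≡walsh p A)) ⟩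
    fourierMass t p
      ≤⟨ fourierMass≤1 n p p₃ ⟩
    1ℚ ∎
    where
    f : Vec Bool n → ℚ
    f x = signℚ (p x)

theorem1p1 : (n k : ℕ) → 1 ≤ n → (p : Vec Bool n → Bool) → IsDegLe2 p →
    (q : ℚ) → 0ℚ ≤ℚ q → (1ℚ + 1ℚ) < q * q →
      fourierWeight (λ x → signℚ (p x)) k ≤ℚ ((1ℚ + q) ^ℚ k)
theorem1p1 n k _ p (c , a , B , p≗quadPoly) q 0≤q 2<q² =
  let t , t[1+q]≡1 , 0≤t , t≤1 , [1+t]²≤2 = reciprocal-admissible q 0≤q 2<q²
  in reciprocal-^ℚ-bound k t[1+q]≡1 0≤1+q (fourierWeight-bound 0≤t t≤1 [1+t]²≤2 p p₃ k)
  where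
  0≤1+q : 0ℚ ≤ℚ 1ℚ + q
  0≤1+q = ℚ.+-mono-≤ (ℚ.nonNegative⁻¹ 1ℚ) 0≤q
  p₃ : Quadratic p
  p₃ = DegreeBelow-cong (sym ∘ p≗quadPoly) (quadPoly-quadratic c a B)
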